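{- For every constant $c\ge1$ there exist two matroids $M_1=(E,\mathcal I_1)$, $M_2=(E,\mathcal I_2)$ on a common finite ground set, a weight function $w:E\to\mathbb R_{\ge0}$ and a stream order of $E$ such that, if $S$ is the set produced by Algorithm LR (described in the context) and $T$ is the output of the reverse greedy procedure on $S$, then $w(T)<w(S^*)/c$, where $S^*$ is a maximum-weight set independent in both matroids. That is, reverse greedy on $S$ does not provide any constant-factor approximation.
   Context: For a matroid $M$, $\mathrm{span}_M(X)=\{e:\mathrm{rank}_M(X\cup\{e\})=\mathrm{rank}_M(X)\}$. Algorithm LR: initialize $S=\emptyset$; elements arrive in stream order. When $e$ arrives, for $i=1,2$ compute $w_i^*(e)=\max\bigl(\{0\}\cup\{\theta: e\in\mathrm{span}_{M_i}(\{f\in S:w_i(f)\ge\theta\})\}\bigr)$. If $w(e)>w_1^*(e)+w_2^*(e)$, set $g(e)=w(e)-w_1^*(e)-w_2^*(e)$, $w_i(e)=w_i^*(e)+g(e)$ for $i=1,2$, and add $e$ to $S$; otherwise discard $e$. Reverse greedy on $S$: start with $T=\emptyset$ and consider the elements of $S$ in the reverse of the order in which they were added to $S$, adding an element to $T$ whenever $T$ together with it is independent in both $M_1$ and $M_2$ (weights are ignored).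
   Formalization: The constant c ranges over the rationals with $c\ge1$, and the weight function w takes values in the nonnegative rationals instead of the nonnegative reals. -}

module Defs where

open import Data.Nat using (ℕ; zero; suc) renaming (_≤_ to _≤ℕ_; _<_ to _<ℕ_)
open import Data.Bool using (Bool; true; false; if_then_else_)
open import Data.Fin using (Fin)
open import Data.Fin.Subset using (Subset; ⊥; ⁅_⁆; _∪_; _⊆_; _∈_; _∉_; ∣_∣)
open import Data.Vec using (Vec; tabulate; zipWith; foldr′)
open import Data.List using (List; []; _∷_; _++_; [_]; map; filter; reverse)
open import Data.Product using (Σ; ∃; _×_; _,_; proj₁; proj₂)
open import Data.Sum using (_⊎_)
open import Relation.Nullary using (¬_)
open import Relation.Binary.PropositionalEquality using (_≡_)
open import Data.Rational using (ℚ; 0ℚ; _+_; _-_; _≤_; _<_)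
open import Data.Rational.Properties using (_≤?_)

record Matroid (n : ℕ) : Set₁ where
  field
    Indep    : Subset n → Set
    indep-∅  : Indep ⊥
    indep-⊆  : ∀ {X Y} → Y ⊆ X → Indep X → Indep Y
    exchange : ∀ {X Y} → Indep X → Indep Y → ∣ X ∣ <ℕ ∣ Y ∣ →
               ∃ λ e → e ∈ Y × e ∉ X × Indep (X ∪ ⁅ e ⁆)
open Matroid public

module _ {n : ℕ} (M : Matroid n) where
  IsRank : Subset n → ℕ → Set
  IsRank X r = (∃ λ I → I ⊆ X × Indep M I × ∣ I ∣ ≡ r)
             × (∀ I → I ⊆ X → Indep M I → ∣ I ∣ ≤ℕ r)

  InSpan : Subset n → Fin n → Set
  InSpan X e = ∃ λ r → IsRank X r × IsRank (X ∪ ⁅ e ⁆) r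

IsMax0 : (ℚ → Set) → ℚ → Set
IsMax0 P v = (v ≡ 0ℚ ⊎ P v) × 0ℚ ≤ v × (∀ θ → P θ → θ ≤ v)

toSubset : {n : ℕ} → List (Fin n) → Subset n
toSubset []       = ⊥
toSubset (e ∷ es) = ⁅ e ⁆ ∪ toSubset es

weight : {n : ℕ} → (Fin n → ℚ) → Subset n → ℚ
weight w X = foldr′ _+_ 0ℚ (zipWith (λ b x → if b then x else 0ℚ) X (tabulate w))

-- An entry of the stored set S: element e with its potentials w₁(e), w₂(e).
Entry : ℕ → Set
Entry n = Fin n × ℚ × ℚ

elemOf : {n : ℕ} → Entry n → Fin n
elemOf = proj₁

pot₁ pot₂ : {n : ℕ} → Entry n → ℚ
pot₁ x = proj₁ (proj₂ x)
pot₂ x = proj₂ (proj₂ x)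

upper : {n : ℕ} → (Entry n → ℚ) → List (Entry n) → ℚ → Subset n
upper wi S θ = toSubset (map elemOf (filter (λ x → θ ≤? wi x) S))

IsThreshold : {n : ℕ} → Matroid n → (Entry n → ℚ) → List (Entry n) → Fin n → ℚ → Set
IsThreshold M wi S e v = IsMax0 (λ θ → InSpan M (upper wi S θ) e) v

module _ {n : ℕ} (M₁ M₂ : Matroid n) (w : Fin n → ℚ) where
  -- LRSteps S stream S' : starting from stored list S (in order of addition),
  -- processing the remaining stream yields the final stored list S'.
  data LRSteps : List (Entry n) → List (Fin n) → List (Entry n) → Set where
    done : ∀ {S} → LRSteps S [] S
    add  : ∀ {S e es S'} v₁ v₂ →
           IsThreshold M₁ pot₁ S e v₁ → IsThreshold M₂ pot₂ S e v₂ →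
           v₁ + v₂ < w e →
           LRSteps (S ++ [ (e , v₁ + (w e - v₁ - v₂) , v₂ + (w e - v₁ - v₂)) ]) es S' →
           LRSteps S (e ∷ es) S'
    skip : ∀ {S e es S'} v₁ v₂ →
           IsThreshold M₁ pot₁ S e v₁ → IsThreshold M₂ pot₂ S e v₂ →
           w e ≤ v₁ + v₂ →
           LRSteps S es S' →
           LRSteps S (e ∷ es) S'

  LR : List (Fin n) → List (Entry n) → Set
  LR stream S = LRSteps [] stream S

  CommonIndep : Subset n → Set
  CommonIndep X = Indep M₁ X × Indep M₂ X

  data Greedy : List (Fin n) → Subset n → Subset n → Set where
    done : ∀ {T} → Greedy [] T T
    take : ∀ {e es T T'} → CommonIndep (T ∪ ⁅ e ⁆) →
           Greedy es (T ∪ ⁅ e ⁆) T' → Greedy (e ∷ es) T T'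
    skip : ∀ {e es T T'} → ¬ CommonIndep (T ∪ ⁅ e ⁆) →
           Greedy es T T' → Greedy (e ∷ es) T T'

  ReverseGreedy : List (Entry n) → Subset n → Set
  ReverseGreedy S T = Greedy (reverse (map elemOf S)) ⊥ T

  MaxCommon : Subset n → Set
  MaxCommon X = CommonIndep X × (∀ Y → CommonIndep Y → weight w Y ≤ weight w X)

-- Take M₁ = U(2,3), M₂ the free matroid on three elements {h, y, x}, weights
-- w(h) = 3c, w(y) = 1, w(x) = 2 and the stream h, y, x. Algorithm LR keeps
-- every element: h and y meet empty thresholds, and x, although spanned in M₁
-- by the pair {h, y} of potentials ≥ 1, still has weight 2 > 1 + 0. Reverse
-- greedy then starts from the cheap late elements x and y, which already form
-- a basis of M₁, so it returns {x, y} of weight 3, while {h, x} weighs 3c + 2.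
module Submission where

open import Defs
open import Data.Nat using (ℕ)
open import Data.Fin using (Fin)
open import Data.Fin.Subset using (Subset)
open import Data.Fin.Permutation using (Permutation′; _⟨$⟩ʳ_)
open import Data.List using (List; map; allFin)
open import Data.Product using (Σ; ∃; _×_)
open import Data.Rational using (ℚ; 0ℚ; 1ℚ; _*_; _≤_; _<_)

open import Data.Nat using (suc; z≤n; s≤s) renaming (_≤_ to _≤ℕ_; _<_ to _<ℕ_; _+_ to _+ℕ_)
import Data.Nat.Properties as ℕ
open import Data.Fin using (zero; suc)
open import Data.Fin.Subset using (⊥; ⁅_⁆; _∪_; _⊆_; _∈_; _∉_; ∣_∣; inside; outside)
open import Data.Fin.Subset.Properties
  using (_∈?_; ∣⊥∣≡0; ∣⁅x⁆∣≡1; p⊆q⇒∣p∣≤∣q∣; p⊂q⇒∣p∣<∣q∣; ⊆-refl; ⊆-reflexive; ⊆-trans;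
         p⊆p∪q; q⊆p∪q; x∈p∪q⁺; x∈p∪q⁻; x∈⁅x⁆)
open import Data.Vec using ([]; _∷_; there)
open import Data.List using ([]; _∷_)
open import Data.List.Properties using (filter-accept; filter-reject)
open import Data.Product using (_,_; proj₂)
open import Data.Sum using (inj₁; inj₂; map₁; map₂)
open import Data.Empty using (⊥-elim)
open import Data.Unit using (⊤; tt)
open import Function using (_∘′_)
open import Relation.Nullary using (¬_; yes; no; contradiction)
open import Relation.Nullary.Decidable using (from-yes; ¬?; _×-dec_)
open import Data.Fin.Properties using (any?)
open import Relation.Binary.PropositionalEquality using (_≡_; refl; sym; cong; subst; module ≡-Reasoning)
open import Data.Integer using (+_)
open import Data.Rational using (_+_; _-_; _/_)
open import Data.Rational.Properties
  using (_≤?_; _<?_; <-irrefl; ≤-antisym; ≤-refl; ≤-trans; <-≤-trans; +-identityˡ; +-identityʳ;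
         +-monoʳ-<; *-monoʳ-≤-nonNeg)
import Data.Fin.Permutation as Permutation

private variable n : ℕ

∪-monoʳ-⊆ : ∀ (p : Subset n) {q r} → q ⊆ r → p ∪ q ⊆ p ∪ r
∪-monoʳ-⊆ p {q} q⊆r x∈p∪q = x∈p∪q⁺ (map₂ q⊆r (x∈p∪q⁻ p q x∈p∪q))

∪-monoˡ-⊆ : ∀ {p q : Subset n} r → p ⊆ q → p ∪ r ⊆ q ∪ r
∪-monoˡ-⊆ {p = p} r p⊆q x∈p∪r = x∈p∪q⁺ (map₁ p⊆q (x∈p∪q⁻ p r x∈p∪r))

∣p∪q∣≤∣p∣+∣q∣ : ∀ (p q : Subset n) → ∣ p ∪ q ∣ ≤ℕ ∣ p ∣ +ℕ ∣ q ∣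
∣p∪q∣≤∣p∣+∣q∣ []            []            = z≤n
∣p∪q∣≤∣p∣+∣q∣ (outside ∷ p) (outside ∷ q) = ∣p∪q∣≤∣p∣+∣q∣ p q
∣p∪q∣≤∣p∣+∣q∣ (outside ∷ p) (inside  ∷ q) =
  ℕ.≤-trans (s≤s (∣p∪q∣≤∣p∣+∣q∣ p q)) (ℕ.≤-reflexive (sym (ℕ.+-suc ∣ p ∣ ∣ q ∣)))
∣p∪q∣≤∣p∣+∣q∣ (inside  ∷ p) (outside ∷ q) = s≤s (∣p∪q∣≤∣p∣+∣q∣ p q)
∣p∪q∣≤∣p∣+∣q∣ (inside  ∷ p) (inside  ∷ q) =
  s≤s (ℕ.≤-trans (∣p∪q∣≤∣p∣+∣q∣ p q) (ℕ.+-monoʳ-≤ ∣ p ∣ (ℕ.n≤1+n ∣ q ∣)))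

∣p∣<∣q∣⇒∃x∈q∉p : ∀ {p q : Subset n} → ∣ p ∣ <ℕ ∣ q ∣ → ∃ λ x → x ∈ q × x ∉ p
∣p∣<∣q∣⇒∃x∈q∉p {p = p} {q} ∣p∣<∣q∣ with any? (λ x → x ∈? q ×-dec ¬? (x ∈? p))
... | yes x∈q∉p = x∈q∉p
... | no  q⊈p   = contradiction (p⊆q⇒∣p∣≤∣q∣ q⊆p) (ℕ.<⇒≱ ∣p∣<∣q∣)
  where
  q⊆p : q ⊆ p
  q⊆p {x} x∈q with x ∈? p
  ... | yes x∈p = x∈p
  ... | no  x∉p = contradiction (x , x∈q , x∉p) q⊈p

uniform : ℕ → (n : ℕ) → Matroid n
uniform k n = record
  { Indep    = λ X → ∣ X ∣ ≤ℕ k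
  ; indep-∅  = ℕ.≤-trans (ℕ.≤-reflexive (∣⊥∣≡0 n)) z≤n
  ; indep-⊆  = λ Y⊆X ∣X∣≤k → ℕ.≤-trans (p⊆q⇒∣p∣≤∣q∣ Y⊆X) ∣X∣≤k
  ; exchange = exchange′
  }
  where
  open ℕ.≤-Reasoning
  exchange′ : ∀ {X Y : Subset n} → ∣ X ∣ ≤ℕ k → ∣ Y ∣ ≤ℕ k → ∣ X ∣ <ℕ ∣ Y ∣ →
              ∃ λ e → e ∈ Y × e ∉ X × ∣ X ∪ ⁅ e ⁆ ∣ ≤ℕ k
  exchange′ {X} {Y} _ ∣Y∣≤k ∣X∣<∣Y∣ with ∣p∣<∣q∣⇒∃x∈q∉p ∣X∣<∣Y∣
  ... | e , e∈Y , e∉X = e , e∈Y , e∉X , (begin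
    ∣ X ∪ ⁅ e ⁆ ∣       ≤⟨ ∣p∪q∣≤∣p∣+∣q∣ X ⁅ e ⁆ ⟩
    ∣ X ∣ +ℕ ∣ ⁅ e ⁆ ∣  ≡⟨ cong (∣ X ∣ +ℕ_) (∣⁅x⁆∣≡1 e) ⟩
    ∣ X ∣ +ℕ 1          ≡⟨ ℕ.+-comm ∣ X ∣ 1 ⟩
    suc ∣ X ∣           ≤⟨ ∣X∣<∣Y∣ ⟩
    ∣ Y ∣               ≤⟨ ∣Y∣≤k ⟩
    k                   ∎)

free : (n : ℕ) → Matroid n
free n = record
  { Indep    = λ _ → ⊤
  ; indep-∅  = tt
  ; indep-⊆  = λ _ _ → tt
  ; exchange = λ _ _ ∣X∣<∣Y∣ → let e , e∈Y , e∉X = ∣p∣<∣q∣⇒∃x∈q∉p ∣X∣<∣Y∣ in e , e∈Y , e∉X , tt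
  }

uniform-spans : ∀ {k} {X : Subset n} e → ∣ X ∣ ≡ k → InSpan (uniform k n) X e
uniform-spans {X = X} e ∣X∣≡k =
  _ , ((X , ⊆-refl , ℕ.≤-reflexive ∣X∣≡k , ∣X∣≡k) , λ _ _ ∣I∣≤k → ∣I∣≤k)
    , ((X , p⊆p∪q ⁅ e ⁆ , ℕ.≤-reflexive ∣X∣≡k , ∣X∣≡k) , λ _ _ ∣I∣≤k → ∣I∣≤k)

module _ (M : Matroid n) where

  IsRank⇒≤∣∣ : ∀ {X r} → IsRank M X r → r ≤ℕ ∣ X ∣
  IsRank⇒≤∣∣ ((_ , I⊆X , _ , refl) , _) = p⊆q⇒∣p∣≤∣q∣ I⊆X

  ¬InSpan-⊆ : ∀ {X Y e} → X ⊆ Y → e ∉ Y → Indep M (Y ∪ ⁅ e ⁆) → ¬ InSpan M X e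
  ¬InSpan-⊆ {X} {Y} {e} X⊆Y e∉Y indep (r , rank-X , rank-X∪e) =
    ℕ.<-irrefl refl (begin-strict
      ∣ X ∣          <⟨ p⊂q⇒∣p∣<∣q∣ (p⊆p∪q ⁅ e ⁆ , e , x∈p∪q⁺ (inj₂ (x∈⁅x⁆ e)) , e∉Y ∘′ X⊆Y) ⟩
      ∣ X ∪ ⁅ e ⁆ ∣  ≤⟨ proj₂ rank-X∪e _ ⊆-refl (indep-⊆ M (∪-monoˡ-⊆ ⁅ e ⁆ X⊆Y) indep) ⟩
      r              ≤⟨ IsRank⇒≤∣∣ rank-X ⟩
      ∣ X ∣          ∎)
    where
    open ℕ.≤-Reasoning

IsMax0-unique : ∀ {P : ℚ → Set} {u v} → IsMax0 P u → IsMax0 P v → u ≡ v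
IsMax0-unique max-u max-v = ≤-antisym (≤-max max-u max-v) (≤-max max-v max-u)
  where
  ≤-max : ∀ {P : ℚ → Set} {u v} → IsMax0 P u → IsMax0 P v → u ≤ v
  ≤-max (inj₁ refl , _) (_ , 0≤v , _)    = 0≤v
  ≤-max (inj₂ P-u  , _) (_ , _   , ≥P-v) = ≥P-v _ P-u

elements : List (Entry n) → Subset n
elements S = toSubset (map elemOf S)

module _ (wi : Entry n → ℚ) (θ : ℚ) where

  upper-accept : ∀ {x} S → θ ≤ wi x → upper wi (x ∷ S) θ ≡ ⁅ elemOf x ⁆ ∪ upper wi S θ
  upper-accept S θ≤wi-x = cong (toSubset ∘′ map elemOf) (filter-accept (λ z → θ ≤? wi z) {xs = S} θ≤wi-x)

  upper-reject : ∀ {x} S → ¬ θ ≤ wi x → upper wi (x ∷ S) θ ≡ upper wi S θ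
  upper-reject S θ≰wi-x = cong (toSubset ∘′ map elemOf) (filter-reject (λ z → θ ≤? wi z) {xs = S} θ≰wi-x)

  upper-∷-⊆ : ∀ x S → upper wi (x ∷ S) θ ⊆ ⁅ elemOf x ⁆ ∪ upper wi S θ
  upper-∷-⊆ x S with θ ≤? wi x
  ... | yes θ≤wi-x = ⊆-reflexive (upper-accept S θ≤wi-x)
  ... | no  θ≰wi-x = ⊆-trans (⊆-reflexive (upper-reject S θ≰wi-x)) (q⊆p∪q _ _)

  upper⊆elements : ∀ S → upper wi S θ ⊆ elements S
  upper⊆elements []      = ⊆-refl
  upper⊆elements (x ∷ S) = ⊆-trans (upper-∷-⊆ x S) (∪-monoʳ-⊆ ⁅ elemOf x ⁆ (upper⊆elements S))

threshold-zero : ∀ (M : Matroid n) wi S e → e ∉ elements S → Indep M (elements S ∪ ⁅ e ⁆) →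
                 IsThreshold M wi S e 0ℚ
threshold-zero M wi S e e∉S indep =
  inj₁ refl , ≤-refl , λ θ spans → ⊥-elim (¬InSpan-⊆ M (upper⊆elements wi θ S) e∉S indep spans)

<⇒≱ : ∀ {p q : ℚ} → p < q → ¬ q ≤ p
<⇒≱ p<q q≤p = <-irrefl refl (<-≤-trans p<q q≤p)

module _ {n} (M₁ M₂ : Matroid n) (w : Fin n → ℚ) where

  LRSteps-functional : ∀ {S es S₁ S₂} → LRSteps M₁ M₂ w S es S₁ → LRSteps M₁ M₂ w S es S₂ → S₁ ≡ S₂
  LRSteps-functional done done = refl
  LRSteps-functional (add _ _ t₁ t₂ _ r) (add _ _ t₁′ t₂′ _ r′)
    with IsMax0-unique t₁ t₁′ | IsMax0-unique t₂ t₂′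
  ... | refl | refl = LRSteps-functional r r′
  LRSteps-functional (add _ _ t₁ t₂ kept _) (skip _ _ t₁′ t₂′ dropped _)
    with IsMax0-unique t₁ t₁′ | IsMax0-unique t₂ t₂′
  ... | refl | refl = ⊥-elim (<⇒≱ kept dropped)
  LRSteps-functional (skip _ _ t₁ t₂ dropped _) (add _ _ t₁′ t₂′ kept _)
    with IsMax0-unique t₁ t₁′ | IsMax0-unique t₂ t₂′
  ... | refl | refl = ⊥-elim (<⇒≱ kept dropped)
  LRSteps-functional (skip _ _ _ _ _ r) (skip _ _ _ _ _ r′) = LRSteps-functional r r′

  Greedy-functional : ∀ {es T T₁ T₂} → Greedy M₁ M₂ w es T T₁ → Greedy M₁ M₂ w es T T₂ → T₁ ≡ T₂
  Greedy-functional done         done          = refl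
  Greedy-functional (take _ g)   (take _ g′)   = Greedy-functional g g′
  Greedy-functional (take i _)   (skip ¬i _)   = contradiction i ¬i
  Greedy-functional (skip ¬i _)  (take i _)    = contradiction i ¬i
  Greedy-functional (skip _ g)   (skip _ g′)   = Greedy-functional g g′

2ℚ 3ℚ : ℚ
2ℚ = + 2 / 1
3ℚ = + 3 / 1

module Counterexample (c : ℚ) (1≤c : 1ℚ ≤ c) where

  M₁ M₂ : Matroid 3
  M₁ = uniform 2 3
  M₂ = free 3

  h y x : Fin 3
  h = zero
  y = suc zero
  x = suc (suc zero)

  H : ℚ
  H = c * 3ℚ

  1≤H : 1ℚ ≤ H
  1≤H = ≤-trans (from-yes (1ℚ ≤? 1ℚ * 3ℚ)) (*-monoʳ-≤-nonNeg 3ℚ 1≤c)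

  w : Fin 3 → ℚ
  w zero             = H
  w (suc zero)       = 1ℚ
  w (suc (suc zero)) = 2ℚ

  w-nonneg : ∀ e → 0ℚ ≤ w e
  w-nonneg zero             = ≤-trans (from-yes (0ℚ ≤? 1ℚ)) 1≤H
  w-nonneg (suc zero)       = from-yes (0ℚ ≤? 1ℚ)
  w-nonneg (suc (suc zero)) = from-yes (0ℚ ≤? 2ℚ)

  stream : List (Fin 3)
  stream = h ∷ y ∷ x ∷ []

  entry : Fin 3 → ℚ → ℚ → Entry 3
  entry e v₁ v₂ = e , v₁ + (w e - v₁ - v₂) , v₂ + (w e - v₁ - v₂)

  Sₕ Sₕᵧ Sₕᵧₓ : List (Entry 3)
  Sₕ   = entry h 0ℚ 0ℚ ∷ []
  Sₕᵧ  = entry h 0ℚ 0ℚ ∷ entry y 0ℚ 0ℚ ∷ []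
  Sₕᵧₓ = entry h 0ℚ 0ℚ ∷ entry y 0ℚ 0ℚ ∷ entry x 1ℚ 0ℚ ∷ []

  potential-h≡H : pot₁ (entry h 0ℚ 0ℚ) ≡ H
  potential-h≡H = begin
    0ℚ + (H - 0ℚ - 0ℚ)  ≡⟨ +-identityˡ _ ⟩
    H - 0ℚ - 0ℚ         ≡⟨ +-identityʳ _ ⟩
    H - 0ℚ              ≡⟨ +-identityʳ H ⟩
    H                   ∎
    where open ≡-Reasoning

  x-threshold₁ : IsThreshold M₁ pot₁ Sₕᵧ x 1ℚ
  x-threshold₁ = inj₂ spanned-at-1 , from-yes (0ℚ ≤? 1ℚ) , unspanned-above-1
    where
    spanned-at-1 : InSpan M₁ (upper pot₁ Sₕᵧ 1ℚ) x
    spanned-at-1 = subst (λ X → InSpan M₁ X x)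
      (sym (upper-accept pot₁ 1ℚ _ (subst (1ℚ ≤_) (sym potential-h≡H) 1≤H)))
      (uniform-spans x refl)
    unspanned-above-1 : ∀ θ → InSpan M₁ (upper pot₁ Sₕᵧ θ) x → θ ≤ 1ℚ
    unspanned-above-1 θ spanned with θ ≤? 1ℚ
    ... | yes θ≤1 = θ≤1
    ... | no  θ≰1 =
      ⊥-elim (¬InSpan-⊆ M₁ {Y = ⁅ h ⁆ ∪ ⊥} {e = x} only-h (λ { (there (there ())) }) (s≤s (s≤s z≤n)) spanned)
      where
      only-h : upper pot₁ Sₕᵧ θ ⊆ ⁅ h ⁆ ∪ ⊥
      only-h = ⊆-trans (upper-∷-⊆ pot₁ θ _ _) (∪-monoʳ-⊆ ⁅ h ⁆ (⊆-reflexive (upper-reject pot₁ θ [] θ≰1)))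

  run : LR M₁ M₂ w stream Sₕᵧₓ
  run = add 0ℚ 0ℚ (threshold-zero M₁ pot₁ [] h (λ ()) (s≤s z≤n))
                  (threshold-zero M₂ pot₂ [] h (λ ()) tt)
                  (<-≤-trans (from-yes (0ℚ <? 1ℚ)) 1≤H)
      (add 0ℚ 0ℚ (threshold-zero M₁ pot₁ Sₕ y (λ { (there ()) }) (s≤s (s≤s z≤n)))
                 (threshold-zero M₂ pot₂ Sₕ y (λ { (there ()) }) tt)
                 (from-yes (0ℚ + 0ℚ <? 1ℚ))
      (add 1ℚ 0ℚ x-threshold₁
                 (threshold-zero M₂ pot₂ Sₕᵧ x (λ { (there (there ())) }) tt)
                 (from-yes (1ℚ + 0ℚ <? 2ℚ))
      done))

  T₀ : Subset 3
  T₀ = (⊥ ∪ ⁅ x ⁆) ∪ ⁅ y ⁆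

  greedy : ReverseGreedy M₁ M₂ w Sₕᵧₓ T₀
  greedy = take (s≤s z≤n , tt) (take (s≤s (s≤s z≤n) , tt) (skip dependent done))
    where
    dependent : ¬ CommonIndep M₁ M₂ w (T₀ ∪ ⁅ h ⁆)
    dependent (s≤s (s≤s ()) , _)

  Sopt : Subset 3
  Sopt = ⁅ h ⁆ ∪ ⁅ x ⁆

  Sopt-common : CommonIndep M₁ M₂ w Sopt
  Sopt-common = s≤s (s≤s z≤n) , tt

  -- weight w T₀ and weight w Sopt compute to 3ℚ and H + 2ℚ.
  reverse-greedy-loses : c * weight w T₀ < weight w Sopt
  reverse-greedy-loses = subst (_< H + 2ℚ) (+-identityʳ H) (+-monoʳ-< H (from-yes (0ℚ <? 2ℚ)))

lemma3p1 : (c : ℚ) → 1ℚ ≤ c →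
    Σ ℕ λ n → Σ (Matroid n) λ M₁ → Σ (Matroid n) λ M₂ →
    Σ (Fin n → ℚ) λ w → (∀ e → 0ℚ ≤ w e) × Σ (Permutation′ n) λ π →
      (∃ λ S → ∃ λ T → LR M₁ M₂ w (map (π ⟨$⟩ʳ_) (allFin n)) S × ReverseGreedy M₁ M₂ w S T)
      × (∀ S T Sstar → LR M₁ M₂ w (map (π ⟨$⟩ʳ_) (allFin n)) S → ReverseGreedy M₁ M₂ w S T →
           MaxCommon M₁ M₂ w Sstar → c * weight w T < weight w Sstar)
lemma3p1 c 1≤c = 3 , M₁ , M₂ , w , w-nonneg , Permutation.id , (Sₕᵧₓ , T₀ , run , greedy) , beaten
  where
  open Counterexample c 1≤c
  beaten : ∀ S T Sstar → LR M₁ M₂ w stream S → ReverseGreedy M₁ M₂ w S T →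
           MaxCommon M₁ M₂ w Sstar → c * weight w T < weight w Sstar
  beaten S T Sstar lr rg (_ , Sstar-max) with LRSteps-functional M₁ M₂ w lr run
  ... | refl with Greedy-functional M₁ M₂ w rg greedy
  ... | refl = <-≤-trans reverse-greedy-loses (Sstar-max Sopt Sopt-common)
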